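{- For all integers $k\ge 5$ and $q\ge 1$, the graph $G(q,k)$ is $C_5$-free.
   Context: For integers $q\ge 1$ and $k\ge 3$, $G(q,k)$ is the graph on vertex set $\{v_0,v_1,\dots,v_{kq}\}$ in which, with all indices taken modulo $kq+1$, the neighbourhood of $v_i$ is $\{v_{i-1},v_{i+1}\}\cup\{v_{i+kj+m} : m=2,3,\dots,k-1,\ j=0,1,\dots,q-1\}$. $C_5$ is the cycle on $5$ vertices. A graph is $H$-free if it contains no induced subgraph isomorphic to $H$. -}

module Defs where

open import Data.Nat using (ℕ; zero; suc; _+_; _*_; _∸_; _≤_; _<_; NonZero)
open import Data.Nat.DivMod using (_%_)
open import Data.Fin using (Fin; toℕ)
open import Data.Product using (Σ; ∃; _×_; _,_)
open import Data.Sum using (_⊎_)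
open import Relation.Binary.PropositionalEquality using (_≡_; _≢_)
open import Relation.Nullary using (¬_)
open import Function.Definitions using (Injective)

record Graph (n : ℕ) : Set₁ where
  field
    Adj : Fin n → Fin n → Set

open Graph public

order : ℕ → ℕ → ℕ
order q k = k * q + 1

modN : (q k x : ℕ) → ℕ
modN q k x = x % suc (k * q)

-- v_j is in the neighbourhood of v_i in G(q,k):
--   j ≡ i-1 or j ≡ i+1 (mod kq+1), or
--   j ≡ i + k*t + m (mod kq+1) for some m ∈ {2,…,k-1}, t ∈ {0,…,q-1}.
-- (i-1 is expressed as i + kq, which is ≡ i-1 mod kq+1.)
GAdj : (q k : ℕ) → Fin (order q k) → Fin (order q k) → Set
GAdj q k i j =
    (toℕ j ≡ modN q k (toℕ i + k * q))
  ⊎ (toℕ j ≡ modN q k (toℕ i + 1))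
  ⊎ (Σ ℕ λ m → Σ ℕ λ t → (2 ≤ m) × (m < k) × (t < q)
       × (toℕ j ≡ modN q k (toℕ i + k * t + m)))

G : (q k : ℕ) → Graph (order q k)
G q k = record { Adj = GAdj q k }

C5Adj : Fin 5 → Fin 5 → Set
C5Adj a b = (toℕ b ≡ (toℕ a + 1) % 5) ⊎ (toℕ a ≡ (toℕ b + 1) % 5)

HasInducedC5 : {n : ℕ} → Graph n → Set
HasInducedC5 {n} Γ =
  Σ (Fin 5 → Fin n) λ f → Injective _≡_ _≡_ f ×
    ((a b : Fin 5) → (C5Adj a b → Adj Γ (f a) (f b)) × (Adj Γ (f a) (f b) → C5Adj a b))

C5-free : {n : ℕ} → Graph n → Set
C5-free Γ = ¬ HasInducedC5 Γ

-- Measure the offset from v_i to v_j as j − i modulo N = kq + 1. The offsets of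
-- neighbours are 1, kq and kt + m (2 ≤ m < k, t < q), so two distinct vertices
-- are non-adjacent exactly when their offset is kt + ε with 1 ≤ t < q and
-- ε ∈ {0, 1}. The complement of an induced C₅ is again a 5-cycle (0,2,4,1,3):
-- its five offsets are of this form, while consecutive pairs add up to the offset
-- of an edge. Since kt + kt′ + 1 reduces modulo N to 0 or to a non-edge offset,
-- all five ε agree. The offsets then sum to kT + 5ε = c(kq + 1) with 1 ≤ c ≤ 4,
-- so c ≡ 5ε (mod k), which is impossible once k ≥ 5.
module Submission where

open import Defs
open import Data.Nat
open import Data.Nat.Properties
open import Data.Nat.DivMod
open import Data.Nat.Divisibility using (_∣_; m%n≡0⇒n∣m)
open import Data.Nat.Tactic.RingSolver using (solve-∀)
open import Data.Fin as Fin using (Fin; toℕ)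
open import Data.Fin.Patterns using (0F; 1F; 2F; 3F; 4F)
open import Data.Fin.Properties using (toℕ<n; toℕ-injective)
open import Data.Product using (∃; ∃₂; _×_; _,_; proj₁; proj₂)
open import Data.Sum using (_⊎_; inj₁; inj₂)
open import Data.Empty using (⊥; ⊥-elim)
open import Function using (_∘_)
open import Relation.Nullary using (¬_)
open import Relation.Nullary.Decidable using (True; False; toWitness; toWitnessFalse; _⊎-dec_)
open import Relation.Binary.Definitions using (Decidable; Tri; tri<; tri≈; tri>)
open import Relation.Binary.PropositionalEquality

%-absorbˡ : ∀ n a b → (a % suc n + b) % suc n ≡ (a + b) % suc n
%-absorbˡ n a b = begin
  (a % N + b) % N          ≡⟨ %-distribˡ-+ (a % N) b N ⟩
  (a % N % N + b % N) % N  ≡⟨ cong (λ u → (u + b % N) % N) (m%n%n≡m%n a N) ⟩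
  (a % N + b % N) % N      ≡⟨ %-distribˡ-+ a b N ⟨
  (a + b) % N              ∎
  where
    open ≡-Reasoning
    N = suc n

%-absorbʳ : ∀ n a b → (a + b % suc n) % suc n ≡ (a + b) % suc n
%-absorbʳ n a b = begin
  (a + b % N) % N  ≡⟨ cong (_% N) (+-comm a (b % N)) ⟩
  (b % N + a) % N  ≡⟨ %-absorbˡ n b a ⟩
  (b + a) % N      ≡⟨ cong (_% N) (+-comm b a) ⟩
  (a + b) % N      ∎
  where
    open ≡-Reasoning
    N = suc n

-- n·x ≡ −x (mod n + 1)
[x+[c+n*x]]%[1+n]≡c%[1+n] : ∀ n x c → (x + (c + n * x)) % suc n ≡ c % suc n
[x+[c+n*x]]%[1+n]≡c%[1+n] n x c = begin
  (x + (c + n * x)) % suc n  ≡⟨ cong (_% suc n) (regroup n x c) ⟩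
  (c + x * suc n) % suc n    ≡⟨ [m+kn]%n≡m%n c x (suc n) ⟩
  c % suc n                  ∎
  where
    open ≡-Reasoning
    regroup : ∀ n x c → x + (c + n * x) ≡ c + x * suc n
    regroup = solve-∀

record Offset (n x d y : ℕ) : Set where
  constructor offset
  field
    reduces : y ≡ (x + d) % suc n

open Offset

offset-trans : ∀ {n x a y b z} → Offset n x a y → Offset n y b z → Offset n x (a + b) z
offset-trans {n} {x} {a} {y} {b} {z} (offset y≡) (offset z≡) = offset (begin
  z                              ≡⟨ z≡ ⟩
  (y + b) % suc n                ≡⟨ cong (λ u → (u + b) % suc n) y≡ ⟩
  ((x + a) % suc n + b) % suc n  ≡⟨ %-absorbˡ n (x + a) b ⟩
  (x + a + b) % suc n            ≡⟨ cong (_% suc n) (+-assoc x a b) ⟩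
  (x + (a + b)) % suc n          ∎)
  where open ≡-Reasoning

offset-reduce : ∀ {n x d y} → Offset n x d y → Offset n x (d % suc n) y
offset-reduce {n} {x} {d} (offset y≡) = offset (trans y≡ (sym (%-absorbʳ n x d)))

offset-self : ∀ {n x} → x < suc n → Offset n x 0 x
offset-self {n} {x} x<N = offset (sym (trans (cong (_% suc n) (+-identityʳ x)) (m<n⇒m%n≡m x<N)))

offset-unique : ∀ {n x a b y} → Offset n x a y → Offset n x b y → a % suc n ≡ b % suc n
offset-unique {n} {x} {a} {b} {y} ya yb = trans (sym (unshift ya)) (unshift yb)
  where
    open ≡-Reasoning
    unshift : ∀ {c} → Offset n x c y → (y + n * x) % suc n ≡ c % suc n
    unshift {c} (offset y≡) = begin
      (y + n * x) % suc n                ≡⟨ cong (λ u → (u + n * x) % suc n) y≡ ⟩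
      ((x + c) % suc n + n * x) % suc n  ≡⟨ %-absorbˡ n (x + c) (n * x) ⟩
      (x + c + n * x) % suc n            ≡⟨ cong (_% suc n) (+-assoc x c (n * x)) ⟩
      (x + (c + n * x)) % suc n          ≡⟨ [x+[c+n*x]]%[1+n]≡c%[1+n] n x c ⟩
      c % suc n                          ∎

offset-loop : ∀ {n x d} → x < suc n → Offset n x d x → d % suc n ≡ 0
offset-loop x<N x≡ = offset-unique x≡ (offset-self x<N)

offset-exists : ∀ n x {y} → y < suc n → ∃ λ d → d < suc n × Offset n x d y
offset-exists n x {y} y<N = (y + n * x) % suc n , m%n<n (y + n * x) (suc n) , offset (sym (begin
  (x + (y + n * x) % suc n) % suc n  ≡⟨ %-absorbʳ n x (y + n * x) ⟩
  (x + (y + n * x)) % suc n          ≡⟨ [x+[c+n*x]]%[1+n]≡c%[1+n] n x y ⟩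
  y % suc n                          ≡⟨ m<n⇒m%n≡m y<N ⟩
  y                                  ∎))
  where open ≡-Reasoning

k*t+r<k*q : ∀ {k t q r} → r < k → t < q → k * t + r < k * q
k*t+r<k*q {k} {t} {q} {r} r<k t<q = begin-strict
  k * t + r  <⟨ +-monoʳ-< (k * t) r<k ⟩
  k * t + k  ≡⟨ +-comm (k * t) k ⟩
  k + k * t  ≡⟨ *-suc k t ⟨
  k * suc t  ≤⟨ *-monoʳ-≤ k t<q ⟩
  k * q      ∎
  where open ≤-Reasoning

residue-unique : ∀ {k a b r s} → r < k → s < k → k * a + r ≡ k * b + s → r ≡ s
residue-unique {zero} () _ _
residue-unique {k@(suc _)} {a} {b} {r} {s} r<k s<k eq = begin
  r                ≡⟨ m<n⇒m%n≡m r<k ⟨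
  r % k            ≡⟨ [m+kn]%n≡m%n r a k ⟨
  (r + a * k) % k  ≡⟨ cong (_% k) (trans (swap a r) (trans eq (sym (swap b s)))) ⟩
  (s + b * k) % k  ≡⟨ [m+kn]%n≡m%n s b k ⟩
  s % k            ≡⟨ m<n⇒m%n≡m s<k ⟩
  s                ∎
  where
    open ≡-Reasoning
    swap : ∀ a r → r + a * k ≡ k * a + r
    swap a r = trans (+-comm r (a * k)) (cong (_+ r) (*-comm a k))

k*a+5ε≢k*b+c : ∀ {k a b ε c} → 5 ≤ k → ε ≤ 1 → 0 < c → c < 5 → k * a + 5 * ε ≢ k * b + c
k*a+5ε≢k*b+c 5≤k z≤n 0<c c<5 eq =
  <⇒≢ 0<c (residue-unique (≤-trans (s≤s z≤n) 5≤k) (<-≤-trans c<5 5≤k) eq)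
k*a+5ε≢k*b+c {k} {a} {b} 5≤k (s≤s z≤n) 0<c c<5 eq with m≤n⇒m<n∨m≡n 5≤k
... | inj₁ 5<k = <⇒≢ c<5 (sym (residue-unique 5<k (<-≤-trans c<5 5≤k) eq))
... | inj₂ refl = <⇒≢ 0<c (residue-unique {5} {suc a} {b} (s≤s z≤n) c<5 (trans (shift a) eq))
  where
    shift : ∀ a → 5 * suc a + 0 ≡ 5 * a + 5
    shift = solve-∀

-- Jump q k d: v_{i+d} is a neighbour of v_i (the backward neighbour v_{i-1} is v_{i+kq}).
data Jump (q k d : ℕ) : Set where
  backward : d ≡ k * q → Jump q k d
  forward  : d ≡ 1 → Jump q k d
  long     : ∀ t m → t < q → 2 ≤ m → m < k → d ≡ k * t + m → Jump q k d

-- For 2 ≤ k these are exactly the offsets in 1 … kq that are not jumps.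
data Skip (q k : ℕ) : ℕ → ℕ → Set where
  skip : ∀ {t ε} → 1 ≤ t → t < q → ε ≤ 1 → Skip q k ε (k * t + ε)

jump<1+kq : ∀ {q k d} → 0 < k * q → Jump q k d → d < suc (k * q)
jump<1+kq _ (backward refl) = n<1+n _
jump<1+kq 0<kq (forward refl) = s≤s 0<kq
jump<1+kq _ (long t m t<q _ m<k refl) = m<n⇒m<1+n (k*t+r<k*q m<k t<q)

jump>0 : ∀ {q k d} → 0 < k * q → Jump q k d → 0 < d
jump>0 0<kq (backward refl) = 0<kq
jump>0 _ (forward refl) = s≤s z≤n
jump>0 {k = k} _ (long t m _ 2≤m _ refl) = ≤-trans (s≤s z≤n) (≤-trans 2≤m (m≤n+m m (k * t)))

skip<kq : ∀ {q k ε d} → 2 ≤ k → Skip q k ε d → d < k * q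
skip<kq 2≤k (skip _ t<q ε≤1) = k*t+r<k*q (<-≤-trans (s≤s ε≤1) 2≤k) t<q

k≤skip : ∀ {q k ε d} → Skip q k ε d → k ≤ d
k≤skip {k = k} (skip {t} {ε} 1≤t _ _) = ≤-trans (m≤m*n k t {{>-nonZero 1≤t}}) (m≤m+n (k * t) ε)

skip⇒¬jump : ∀ {q k ε d} → 2 ≤ k → Skip q k ε d → ¬ Jump q k d
skip⇒¬jump 2≤k s (backward eq) = <⇒≢ (skip<kq 2≤k s) eq
skip⇒¬jump 2≤k s (forward eq) = <⇒≢ (≤-trans 2≤k (k≤skip s)) (sym eq)
skip⇒¬jump 2≤k (skip _ _ ε≤1) (long _ _ _ 2≤m m<k eq) =
  <⇒≢ (<-≤-trans (s≤s ε≤1) 2≤m) (residue-unique (<-≤-trans (s≤s ε≤1) 2≤k) m<k eq)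

jump⊎skip-from-digits : ∀ {q k} t r → r < k → t < q → 0 < k * t + r →
  Jump q k (k * t + r) ⊎ ∃ λ ε → Skip q k ε (k * t + r)
jump⊎skip-from-digits t (suc (suc m)) m<k t<q _ = inj₁ (long t (2 + m) t<q (s≤s (s≤s z≤n)) m<k refl)
jump⊎skip-from-digits (suc t) 0 _ t<q _ = inj₂ (0 , skip (s≤s z≤n) t<q z≤n)
jump⊎skip-from-digits (suc t) 1 _ t<q _ = inj₂ (1 , skip (s≤s z≤n) t<q (s≤s z≤n))
jump⊎skip-from-digits {k = k} 0 0 _ _ 0<d = ⊥-elim (<⇒≢ 0<d (sym (trans (+-identityʳ (k * 0)) (*-zeroʳ k))))
jump⊎skip-from-digits {k = k} 0 1 _ _ _ = inj₁ (forward (cong (_+ 1) (*-zeroʳ k)))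

jump⊎skip : ∀ {q k d} .{{_ : NonZero k}} → 0 < d → d ≤ k * q → Jump q k d ⊎ ∃ λ ε → Skip q k ε d
jump⊎skip {q} {k} {d} 0<d d≤kq with m≤n⇒m<n∨m≡n d≤kq | d divMod k
... | inj₂ d≡kq | _ = inj₁ (backward d≡kq)
... | inj₁ d<kq | result t r d≡r+tk =
  subst (λ e → Jump q k e ⊎ ∃ λ ε → Skip q k ε e) (sym d≡kt+r)
    (jump⊎skip-from-digits t (toℕ r) (toℕ<n r) t<q (subst (0 <_) d≡kt+r 0<d))
  where
    open ≤-Reasoning
    d≡kt+r : d ≡ k * t + toℕ r
    d≡kt+r = trans d≡r+tk (trans (+-comm (toℕ r) (t * k)) (cong (_+ toℕ r) (*-comm t k)))
    t<q : t < q
    t<q = *-cancelʳ-< k t q (begin-strict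
      t * k          ≤⟨ m≤n+m (t * k) (toℕ r) ⟩
      toℕ r + t * k  ≡⟨ d≡r+tk ⟨
      d              <⟨ d<kq ⟩
      k * q          ≡⟨ *-comm k q ⟩
      q * k          ∎)

[k*T+1]%[1+kq]≡0⊎skip : ∀ {q k T} → 2 ≤ k → 1 ≤ T → T < q + q →
  (k * T + 1) % suc (k * q) ≡ 0 ⊎ ∃ λ ε → Skip q k ε ((k * T + 1) % suc (k * q))
[k*T+1]%[1+kq]≡0⊎skip {q} {k} {T} 2≤k 1≤T T<2q = by-cases (<-cmp T q)
  where
    open ≡-Reasoning
    N = suc (k * q)
    reduced : ∀ {ε d} → Skip q k ε d → d % N ≡ d
    reduced s = m<n⇒m%n≡m (m<n⇒m<1+n (skip<kq 2≤k s))
    by-cases : Tri (T < q) (T ≡ q) (q < T) →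
      (k * T + 1) % N ≡ 0 ⊎ ∃ λ ε → Skip q k ε ((k * T + 1) % N)
    by-cases (tri< T<q _ _) = inj₂ (1 , subst (Skip q k 1) (sym (reduced s)) s)
      where
        s : Skip q k 1 (k * T + 1)
        s = skip 1≤T T<q (s≤s z≤n)
    by-cases (tri≈ _ T≡q _) = inj₁ (begin
      (k * T + 1) % N  ≡⟨ cong (λ u → (k * u + 1) % N) T≡q ⟩
      (k * q + 1) % N  ≡⟨ cong (_% N) (+-comm (k * q) 1) ⟩
      N % N            ≡⟨ n%n≡0 N ⟩
      0                ∎)
    by-cases (tri> _ _ q<T) = inj₂ (0 , subst (Skip q k 0) (sym wrap) s)
      where
        u = T ∸ q
        u+q≡T : u + q ≡ T
        u+q≡T = m∸n+n≡m (<⇒≤ q<T)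
        s : Skip q k 0 (k * u + 0)
        s = skip (+-cancelʳ-≤ q 1 u (subst (suc q ≤_) (sym u+q≡T) q<T))
                 (+-cancelʳ-< q u q (subst (_< q + q) (sym u+q≡T) T<2q)) z≤n
        regroup : ∀ k u q → k * (u + q) + 1 ≡ k * u + 0 + suc (k * q)
        regroup = solve-∀
        wrap : (k * T + 1) % N ≡ k * u + 0
        wrap = begin
          (k * T + 1) % N            ≡⟨ cong (λ v → (k * v + 1) % N) u+q≡T ⟨
          (k * (u + q) + 1) % N      ≡⟨ cong (_% N) (regroup k u q) ⟩
          (k * u + 0 + N) % N        ≡⟨ [m+n]%n≡m%n (k * u + 0) N ⟩
          (k * u + 0) % N            ≡⟨ reduced s ⟩
          k * u + 0                  ∎

skip₀+skip₁⇒¬jump : ∀ {q k d d′} → 2 ≤ k → Skip q k 0 d → Skip q k 1 d′ →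
  ¬ Jump q k ((d + d′) % suc (k * q))
skip₀+skip₁⇒¬jump {q} {k} 2≤k (skip {t} 1≤t t<q _) (skip {t′} _ t′<q _) jump =
  zero⊎skip⇒¬jump ([k*T+1]%[1+kq]≡0⊎skip 2≤k (≤-trans 1≤t (m≤m+n t t′)) (+-mono-< t<q t′<q))
    (subst (λ e → Jump q k (e % suc (k * q))) (regroup k t t′) jump)
  where
    regroup : ∀ k t t′ → k * t + 0 + (k * t′ + 1) ≡ k * (t + t′) + 1
    regroup = solve-∀
    0<kq : 0 < k * q
    0<kq = *-mono-≤ (≤-trans (s≤s z≤n) 2≤k) (≤-trans (s≤s z≤n) t<q)
    zero⊎skip⇒¬jump : ∀ {d} → d ≡ 0 ⊎ (∃ λ ε → Skip q k ε d) → ¬ Jump q k d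
    zero⊎skip⇒¬jump (inj₁ refl) jump = <⇒≢ (jump>0 0<kq jump) refl
    zero⊎skip⇒¬jump (inj₂ (_ , s)) = skip⇒¬jump 2≤k s

skip-same-type : ∀ {q k ε ε′ d d′} → 2 ≤ k → Skip q k ε d → Skip q k ε′ d′ →
  Jump q k ((d + d′) % suc (k * q)) → Skip q k ε d′
skip-same-type _ (skip _ _ z≤n) s′@(skip _ _ z≤n) _ = s′
skip-same-type _ (skip _ _ (s≤s z≤n)) s′@(skip _ _ (s≤s z≤n)) _ = s′
skip-same-type 2≤k s@(skip _ _ z≤n) s′@(skip _ _ (s≤s z≤n)) jump = ⊥-elim (skip₀+skip₁⇒¬jump 2≤k s s′ jump)
skip-same-type {q} {k} {d = d} {d′} 2≤k s@(skip _ _ (s≤s z≤n)) s′@(skip _ _ z≤n) jump =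
  ⊥-elim (skip₀+skip₁⇒¬jump 2≤k s′ s (subst (λ e → Jump q k (e % suc (k * q))) (+-comm d d′) jump))

five-skips-%≢0 : ∀ {q k ε d₀ d₁ d₂ d₃ d₄} → 5 ≤ k →
  Skip q k ε d₀ → Skip q k ε d₁ → Skip q k ε d₂ → Skip q k ε d₃ → Skip q k ε d₄ →
  (d₀ + (d₁ + (d₂ + (d₃ + d₄)))) % suc (k * q) ≢ 0
five-skips-%≢0 {q} {k} {ε} 5≤k
  s₀@(skip {t₀} _ _ ε≤1) s₁@(skip {t₁} _ _ _) s₂@(skip {t₂} _ _ _) s₃@(skip {t₃} _ _ _) s₄@(skip {t₄} _ _ _) S%N≡0 =
  k*a+5ε≢k*b+c 5≤k ε≤1 0<c c<5 (begin
    k * (t₀ + t₁ + t₂ + t₃ + t₄) + 5 * ε  ≡⟨ regroup k t₀ t₁ t₂ t₃ t₄ ε ⟨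
    S                                      ≡⟨ S≡cN ⟩
    c * N                                  ≡⟨ expand c k q ⟩
    k * (c * q) + c                        ∎)
  where
    open ≡-Reasoning
    N = suc (k * q)
    S = (k * t₀ + ε) + ((k * t₁ + ε) + ((k * t₂ + ε) + ((k * t₃ + ε) + (k * t₄ + ε))))
    open _∣_ (m%n≡0⇒n∣m S N S%N≡0) renaming (quotient to c; equality to S≡cN)
    regroup : ∀ k t₀ t₁ t₂ t₃ t₄ ε →
      (k * t₀ + ε) + ((k * t₁ + ε) + ((k * t₂ + ε) + ((k * t₃ + ε) + (k * t₄ + ε))))
        ≡ k * (t₀ + t₁ + t₂ + t₃ + t₄) + 5 * ε
    regroup = solve-∀
    expand : ∀ c k q → c * suc (k * q) ≡ k * (c * q) + c
    expand = solve-∀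
    five-times : ∀ N → N + (N + (N + (N + N))) ≡ 5 * N
    five-times = solve-∀
    skip<N : ∀ {d} → Skip q k ε d → d < N
    skip<N s = m<n⇒m<1+n (skip<kq (≤-trans (s≤s (s≤s z≤n)) 5≤k) s)
    S<5N : S < 5 * N
    S<5N = subst (S <_) (five-times N)
      (+-mono-< (skip<N s₀) (+-mono-< (skip<N s₁) (+-mono-< (skip<N s₂) (+-mono-< (skip<N s₃) (skip<N s₄)))))
    c<5 : c < 5
    c<5 = *-cancelʳ-< N c 5 (subst (_< 5 * N) S≡cN S<5N)
    0<S : 0 < S
    0<S = ≤-trans (≤-trans (s≤s z≤n) 5≤k) (≤-trans (k≤skip s₀) (m≤m+n (k * t₀ + ε) _))
    0<c : 0 < c
    0<c = n≢0⇒n>0 (λ c≡0 → <⇒≢ 0<S (sym (trans S≡cN (cong (_* N) c≡0))))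

no-skip-pentagon : ∀ {q k ε₀ ε₁ ε₂ ε₃ ε₄ d₀ d₁ d₂ d₃ d₄} → 5 ≤ k →
  Skip q k ε₀ d₀ → Skip q k ε₁ d₁ → Skip q k ε₂ d₂ → Skip q k ε₃ d₃ → Skip q k ε₄ d₄ →
  Jump q k ((d₀ + d₁) % suc (k * q)) → Jump q k ((d₁ + d₂) % suc (k * q)) →
  Jump q k ((d₂ + d₃) % suc (k * q)) → Jump q k ((d₃ + d₄) % suc (k * q)) →
  (d₀ + (d₁ + (d₂ + (d₃ + d₄)))) % suc (k * q) ≢ 0
no-skip-pentagon {q} {k} {ε₀} {d₁ = d₁} {d₂} {d₃} {d₄} 5≤k s₀ s₁ s₂ s₃ s₄ j₀₁ j₁₂ j₂₃ j₃₄ =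
  five-skips-%≢0 5≤k s₀ s₁′ s₂′ s₃′ s₄′
  where
    2≤k : 2 ≤ k
    2≤k = ≤-trans (s≤s (s≤s z≤n)) 5≤k
    s₁′ : Skip q k ε₀ d₁
    s₁′ = skip-same-type 2≤k s₀ s₁ j₀₁
    s₂′ : Skip q k ε₀ d₂
    s₂′ = skip-same-type 2≤k s₁′ s₂ j₁₂
    s₃′ : Skip q k ε₀ d₃
    s₃′ = skip-same-type 2≤k s₂′ s₃ j₂₃
    s₄′ : Skip q k ε₀ d₄
    s₄′ = skip-same-type 2≤k s₃′ s₄ j₃₄

vertex<1+kq : ∀ q k (x : Fin (order q k)) → toℕ x < suc (k * q)
vertex<1+kq q k x = subst (toℕ x <_) (+-comm (k * q) 1) (toℕ<n x)

jump⇒adj : ∀ {q k d} {x y : Fin (order q k)} → Jump q k d → Offset (k * q) (toℕ x) d (toℕ y) → GAdj q k x y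
jump⇒adj (backward refl) (offset y≡) = inj₁ y≡
jump⇒adj (forward refl) (offset y≡) = inj₂ (inj₁ y≡)
jump⇒adj {q} {k} {x = x} (long t m t<q 2≤m m<k refl) (offset y≡) =
  inj₂ (inj₂ (m , t , 2≤m , m<k , t<q , trans y≡ (cong (modN q k) (sym (+-assoc (toℕ x) (k * t) m)))))

adj⇒jump-offset : ∀ {q k} {x y : Fin (order q k)} → GAdj q k x y →
  ∃ λ d → Jump q k d × Offset (k * q) (toℕ x) d (toℕ y)
adj⇒jump-offset {q} {k} (inj₁ y≡) = k * q , backward refl , offset y≡
adj⇒jump-offset (inj₂ (inj₁ y≡)) = 1 , forward refl , offset y≡
adj⇒jump-offset {q} {k} {x} (inj₂ (inj₂ (m , t , 2≤m , m<k , t<q , y≡))) =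
  k * t + m , long t m t<q 2≤m m<k refl , offset (trans y≡ (cong (modN q k) (+-assoc (toℕ x) (k * t) m)))

adj⇒jump : ∀ {q k d} {x y : Fin (order q k)} → 0 < k * q → GAdj q k x y →
  Offset (k * q) (toℕ x) d (toℕ y) → d < suc (k * q) → Jump q k d
adj⇒jump {q} {k} {d} 0<kq xy o d<N with adj⇒jump-offset xy
... | e , jump , o′ = subst (Jump q k) e≡d jump
  where
    open ≡-Reasoning
    e≡d : e ≡ d
    e≡d = begin
      e                ≡⟨ m<n⇒m%n≡m (jump<1+kq 0<kq jump) ⟨
      e % suc (k * q)  ≡⟨ offset-unique o′ o ⟩
      d % suc (k * q)  ≡⟨ m<n⇒m%n≡m d<N ⟩
      d                ∎

SkipTo : ∀ q k → Fin (order q k) → Fin (order q k) → Set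
SkipTo q k x y = ∃₂ λ ε d → Offset (k * q) (toℕ x) d (toℕ y) × Skip q k ε d

nonadj⇒skip : ∀ {q k} .{{_ : NonZero k}} {x y : Fin (order q k)} → x ≢ y → ¬ GAdj q k x y → SkipTo q k x y
nonadj⇒skip {q} {k} {x} {y} x≢y ¬xy = from-offset (offset-exists (k * q) (toℕ x) (vertex<1+kq q k y))
  where
    from-offset : (∃ λ d → d < suc (k * q) × Offset (k * q) (toℕ x) d (toℕ y)) → SkipTo q k x y
    from-offset (d , d<N , o) = from-class (jump⊎skip {q} {k} (n≢0⇒n>0 d≢0) (≤-pred d<N))
      where
        d≢0 : d ≢ 0
        d≢0 d≡0 = x≢y (toℕ-injective (trans (reduces (offset-self (vertex<1+kq q k x)))
          (sym (trans (reduces o) (cong (λ e → (toℕ x + e) % suc (k * q)) d≡0)))))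
        from-class : Jump q k d ⊎ (∃ λ ε → Skip q k ε d) → SkipTo q k x y
        from-class (inj₁ jump) = ⊥-elim (¬xy (jump⇒adj jump o))
        from-class (inj₂ (ε , s)) = ε , d , o , s

C5Adj? : Decidable C5Adj
C5Adj? a b = (toℕ b ≟ (toℕ a + 1) % 5) ⊎-dec (toℕ a ≟ (toℕ b + 1) % 5)

lemma2p5 : (q k : ℕ) → 5 ≤ k → 1 ≤ q → C5-free (G q k)
lemma2p5 q zero () _
lemma2p5 q k@(suc _) 5≤k 1≤q (f , f-injective , f-hom) =
  pentagon (skip-between 0F 2F) (skip-between 2F 4F) (skip-between 4F 1F) (skip-between 1F 3F) (skip-between 3F 0F)
  where
    skip-between : ∀ a b → {False (a Fin.≟ b)} → {False (C5Adj? a b)} → SkipTo q k (f a) (f b)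
    skip-between a b {a≢b} {a≁b} =
      nonadj⇒skip (toWitnessFalse a≢b ∘ f-injective) (toWitnessFalse a≁b ∘ proj₂ (f-hom a b))
    jump-across : ∀ a c → {True (C5Adj? a c)} → ∀ {b d d′} →
      Offset (k * q) (toℕ (f a)) d (toℕ (f b)) → Offset (k * q) (toℕ (f b)) d′ (toℕ (f c)) →
      Jump q k ((d + d′) % suc (k * q))
    jump-across a c {a~c} {d = d} {d′} ab bc =
      adj⇒jump {q} {k} (*-mono-≤ {1} {k} (s≤s z≤n) 1≤q) (proj₁ (f-hom a c) (toWitness a~c))
        (offset-reduce (offset-trans ab bc)) (m%n<n (d + d′) (suc (k * q)))
    pentagon : SkipTo q k (f 0F) (f 2F) → SkipTo q k (f 2F) (f 4F) → SkipTo q k (f 4F) (f 1F) →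
      SkipTo q k (f 1F) (f 3F) → SkipTo q k (f 3F) (f 0F) → ⊥
    pentagon (_ , _ , o₀ , s₀) (_ , _ , o₁ , s₁) (_ , _ , o₂ , s₂) (_ , _ , o₃ , s₃) (_ , _ , o₄ , s₄) =
      no-skip-pentagon 5≤k s₀ s₁ s₂ s₃ s₄
        (jump-across 0F 4F o₀ o₁) (jump-across 2F 1F o₁ o₂) (jump-across 4F 3F o₂ o₃) (jump-across 1F 0F o₃ o₄)
        (offset-loop (vertex<1+kq q k (f 0F)) (offset-trans o₀ (offset-trans o₁ (offset-trans o₂ (offset-trans o₃ o₄)))))
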